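{- Let $n\ge4$, $Q$ an acyclic quiver of type $D_n$, $\underline d\in\Phi_+$ and $\underline e\in\mathbb Z^n$ with $0\le e_k\le d_k$ for all $k$. Let $w$ be the weight function on edges of the base graph $G$ obtained from the initial weights $w(\varepsilon)=$ multiplicity of $\varepsilon$ in $M_-$ by performing, for each $k$, $e_k$ weighted flips at tile $k$. Then for every arrow $i\to j$ of $Q$, the weight $m_{i,j}$ of the edge shared by tiles $i$ and $j$ satisfies $$m_{i,j}=\max(d_i-d_j,0)+(e_j-e_i).$$
   Context: $Q$ is an acyclic orientation of the Dynkin diagram $D_n$ with vertices $0,\dots,n-1$ and edges $\{i,i+1\}$ ($0\le i\le n-4$), $\{n-3,n-2\}$, $\{n-3,n-1\}$. $\Phi_+$: positive roots of type $D_n$ in simple-root coordinates (the $0/1$ indicator vectors of nonempty connected vertex sets, together with $e_i+\dots+e_{j-1}+2e_j+\dots+2e_{n-3}+e_{n-2}+e_{n-1}$, $0\le i<j\le n-3$). Base graph $G$: planar bipartite black/white graph, union of tiles $0,\dots,n-1$ (tile $n-3$ a hexagon, others squares); tiles $i,j$ share an edge iff adjacent in the diagram; for every arrow $i\to j$ the shared edge goes black to white when traversing tile $i$ clockwise; tiles $0,\dots,n-3$ form a snake (for $1\le i\le n-4$, tiles $i\pm1$ on opposite edges of tile $i$ if the arrows at $i$ point in opposite directions, adjacent edges if in the same direction); tiles $n-4,n-2,n-1$ glued to three distinct hexagon edges at positions fixed by a convention depending on orientation. For a union $H$ of tiles, a boundary edge of $H$ is black-to-white clockwise if it goes from black to white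 when the boundary of $H$ is traversed clockwise, white-to-black clockwise otherwise. $M_-=M_1\sqcup M_2$ (multiset union) where $M_1$ (resp. $M_2$) is the set of black-to-white clockwise boundary edges of the union of tiles with $d_i\ge1$ (resp. $d_i=2$). Weighted flip at tile $i$: decrease by $1$ the weight of every edge of tile $i$ that is black-to-white clockwise w.r.t. tile $i$, increase by $1$ the weight of every edge of tile $i$ that is white-to-black clockwise w.r.t. tile $i$ (weights may become negative; the result does not depend on the order of flips). -}

module Defs where

open import Data.Nat as ℕ using (ℕ; zero; suc)
open import Data.Fin using (Fin; toℕ) renaming (zero to fzero; suc to fsuc)
open import Data.Integer as ℤ using (ℤ; +_; _-_; _*_; _⊔_; _≤?_)
open import Data.Bool using (Bool; true; false; if_then_else_; _∧_)
open import Data.Maybe using (Maybe; just; nothing)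
open import Data.Product using (Σ; _×_; _,_)
open import Data.Sum using (_⊎_)
open import Data.Empty using (⊥)
open import Relation.Nullary using (¬_)
open import Relation.Nullary.Decidable using (⌊_⌋)
open import Relation.Binary.PropositionalEquality using (_≡_; _≢_)

DEdge : (n : ℕ) → Fin n → Fin n → Set
DEdge n i j =
  (toℕ j ≡ suc (toℕ i) × toℕ j ℕ.≤ n ℕ.∸ 3)
  ⊎ (toℕ i ≡ n ℕ.∸ 3 × (toℕ j ≡ n ℕ.∸ 2 ⊎ toℕ j ≡ n ℕ.∸ 1))

Adj : (n : ℕ) → Fin n → Fin n → Set
Adj n i j = DEdge n i j ⊎ DEdge n j i

-- Orientations (quivers) of D_n.  D_n is a tree, so every orientation
-- of its edges is acyclic.

record Quiver (n : ℕ) : Set₁ where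
  field
    Arrow     : Fin n → Fin n → Set
    arrow-adj : ∀ {i j} → Arrow i j → Adj n i j
    orient    : ∀ {i j} → Adj n i j → Arrow i j ⊎ Arrow j i
    antisym   : ∀ {i j} → Arrow i j → Arrow j i → ⊥
open Quiver public

data Reach {n : ℕ} (S : Fin n → Bool) : Fin n → Fin n → Set where
  here : ∀ {a} → S a ≡ true → Reach S a a
  step : ∀ {a b c} → Reach S a b → Adj n b c → S c ≡ true → Reach S a c

NonemptyConnected : (n : ℕ) → (Fin n → Bool) → Set
NonemptyConnected n S =
  Σ (Fin n) (λ a → S a ≡ true)
  × (∀ a b → S a ≡ true → S b ≡ true → Reach S a b)

longRoot : (n i j : ℕ) → Fin n → ℤ
longRoot n i j k =
  if ⌊ toℕ k ℕ.<? i ⌋ then + 0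
  else if ⌊ toℕ k ℕ.<? j ⌋ then + 1
  else if ⌊ toℕ k ℕ.≤? n ℕ.∸ 3 ⌋ then + 2
  else + 1

data PosRoot (n : ℕ) (d : Fin n → ℤ) : Set where
  connected : (S : Fin n → Bool) → NonemptyConnected n S →
              (∀ k → d k ≡ (if S k then + 1 else + 0)) → PosRoot n d
  long      : (i j : ℕ) → i ℕ.< j → j ℕ.≤ n ℕ.∸ 3 →
              (∀ k → d k ≡ longRoot n i j k) → PosRoot n d

-- The base graph G, abstracted to the data relevant for weights.
-- Each edge of a tile carries its orientation w.r.t. that tile:
--   bw : black-to-white when the tile is traversed clockwise
--   wb : white-to-black when the tile is traversed clockwise

data Ori : Set where
  bw wb : Ori

record BaseGraph (n : ℕ) (Q : Quiver n) : Set₁ where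
  field
    Edge    : Set
    -- tileOri k ε = nothing  iff  ε is not an edge of tile k
    tileOri : Fin n → Edge → Maybe Ori
    shared      : (i j : Fin n) → Adj n i j → Edge
    shared-in₁  : ∀ i j (a : Adj n i j) → tileOri i (shared i j a) ≢ nothing
    shared-in₂  : ∀ i j (a : Adj n i j) → tileOri j (shared i j a) ≢ nothing
    shared-uniq : ∀ i j (a : Adj n i j) (ε : Edge) →
                  tileOri i ε ≢ nothing → tileOri j ε ≢ nothing →
                  ε ≡ shared i j a
    nonadj      : ∀ i j (ε : Edge) → i ≢ j → ¬ Adj n i j →
                  tileOri i ε ≢ nothing → tileOri j ε ≢ nothing → ⊥
    -- (planarity) an edge lies on at most two tiles ...
    at-most-two : ∀ i j k (ε : Edge) → i ≢ j → j ≢ k → i ≢ k →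
                  tileOri i ε ≢ nothing → tileOri j ε ≢ nothing →
                  tileOri k ε ≢ nothing → ⊥
    -- ... and two tiles sharing an edge traverse it in opposite directions
    opposite    : ∀ i j (ε : Edge) → i ≢ j →
                  tileOri i ε ≡ just bw → tileOri j ε ≡ just bw → ⊥
    opposite′   : ∀ i j (ε : Edge) → i ≢ j →
                  tileOri i ε ≡ just wb → tileOri j ε ≡ just wb → ⊥
    arrow-bw    : ∀ i j (a : Arrow Q i j) →
                  tileOri i (shared i j (arrow-adj Q a)) ≡ just bw
open BaseGraph public

sumFin : (n : ℕ) → (Fin n → ℤ) → ℤ
sumFin zero    f = + 0
sumFin (suc n) f = f fzero ℤ.+ sumFin n (λ k → f (fsuc k))

isEdgeOf : Maybe Ori → Bool
isEdgeOf (just _) = true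
isEdgeOf nothing  = false

isBW : Maybe Ori → Bool
isBW (just bw) = true
isBW _         = false

b2z : Bool → ℤ
b2z true  = + 1
b2z false = + 0

module _ {n : ℕ} {Q : Quiver n} (G : BaseGraph n Q) where

  tilesContaining : (Fin n → Bool) → Edge G → ℤ
  tilesContaining S ε = sumFin n (λ k → b2z (S k ∧ isEdgeOf (tileOri G k ε)))

  -- multiplicity (0 or 1) of ε among the black-to-white clockwise
  -- boundary edges of H: ε is a boundary edge of H iff it lies on
  -- exactly one tile of H, and then its orientation w.r.t. the clockwise
  -- boundary of H is its orientation w.r.t. that tile.
  bwBoundary : (Fin n → Bool) → Edge G → ℤ
  bwBoundary S ε =
    if ⌊ tilesContaining S ε ℤ.≟ + 1 ⌋
    then sumFin n (λ k → b2z (S k ∧ isBW (tileOri G k ε)))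
    else + 0

  -- multiplicity of ε in M₋ = M₁ ⊔ M₂
  initialWeight : (Fin n → ℤ) → Edge G → ℤ
  initialWeight d ε =
    bwBoundary (λ k → ⌊ + 1 ≤? d k ⌋) ε ℤ.+ bwBoundary (λ k → ⌊ d k ℤ.≟ + 2 ⌋) ε

  flipDelta : Fin n → Edge G → ℤ
  flipDelta k ε with tileOri G k ε
  ... | just bw = ℤ.- + 1
  ... | just wb = + 1
  ... | nothing = + 0

  weight : (d e : Fin n → ℤ) → Edge G → ℤ
  weight d e ε = initialWeight d ε ℤ.+ sumFin n (λ k → e k * flipDelta k ε)

-- The edge ε shared by the tiles of an arrow i → j lies on no other tile, is
-- black-to-white for tile i and white-to-black for tile j.  Hence flips at
-- other tiles do not touch it, the e_i flips at i and e_j flips at j change its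
-- weight by e_j − e_i, and ε is a black-to-white boundary edge of a union H of
-- tiles exactly when tile i ⊆ H and tile j ⊄ H.  Its initial weight is thus
-- [d_i ≥ 1 > d_j] + [d_i = 2 ≠ d_j], which equals max(d_i − d_j, 0) because
-- the coefficients of a positive root of D_n lie in {0, 1, 2}.
module Submission where

open import Defs
open import Data.Nat as ℕ using (ℕ) renaming (_≤_ to _≤ℕ_)
open import Data.Fin using (Fin; toℕ) renaming (zero to fzero; suc to fsuc)
open import Data.Fin.Properties using (suc-injective)
open import Data.Integer as ℤ using (ℤ; +_; _+_; _-_; _*_; -_; _⊔_; _≤_)
import Data.Integer.Properties as ℤ
open import Data.Product using (_×_)
open import Data.Bool using (Bool; true; false; if_then_else_; _∧_; not)
open import Data.Bool.Properties using (∧-zeroʳ)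
open import Data.Maybe using (Maybe; just; nothing)
open import Data.Empty using (⊥; ⊥-elim)
open import Function using (_∘_)
open import Relation.Nullary.Decidable using (⌊_⌋)
open import Relation.Binary.PropositionalEquality

sumFin-zero : ∀ n (f : Fin n → ℤ) → (∀ k → f k ≡ + 0) → sumFin n f ≡ + 0
sumFin-zero ℕ.zero    f f≡0 = refl
sumFin-zero (ℕ.suc n) f f≡0
  rewrite f≡0 fzero | sumFin-zero n (f ∘ fsuc) (f≡0 ∘ fsuc) = refl

sumFin-single : ∀ n (f : Fin n → ℤ) i → (∀ k → k ≢ i → f k ≡ + 0) → sumFin n f ≡ f i
sumFin-single (ℕ.suc n) f fzero f≡0
  rewrite sumFin-zero n (f ∘ fsuc) (λ k → f≡0 (fsuc k) λ ()) = ℤ.+-identityʳ (f fzero)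
sumFin-single (ℕ.suc n) f (fsuc i) f≡0 rewrite f≡0 fzero (λ ()) =
  trans (ℤ.+-identityˡ _)
        (sumFin-single n (f ∘ fsuc) i (λ k k≢i → f≡0 (fsuc k) (k≢i ∘ suc-injective)))

sumFin-pair : ∀ n (f : Fin n → ℤ) i j → i ≢ j → (∀ k → k ≢ i → k ≢ j → f k ≡ + 0) →
              sumFin n f ≡ f i + f j
sumFin-pair (ℕ.suc n) f fzero fzero i≢j _ = ⊥-elim (i≢j refl)
sumFin-pair (ℕ.suc n) f fzero (fsuc j) _ f≡0 =
  cong (_+_ (f fzero))
       (sumFin-single n (f ∘ fsuc) j (λ k k≢j → f≡0 (fsuc k) (λ ()) (k≢j ∘ suc-injective)))
sumFin-pair (ℕ.suc n) f (fsuc i) fzero _ f≡0 =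
  trans (cong (_+_ (f fzero))
              (sumFin-single n (f ∘ fsuc) i (λ k k≢i → f≡0 (fsuc k) (k≢i ∘ suc-injective) (λ ()))))
        (ℤ.+-comm (f fzero) _)
sumFin-pair (ℕ.suc n) f (fsuc i) (fsuc j) i≢j f≡0 rewrite f≡0 fzero (λ ()) (λ ()) =
  trans (ℤ.+-identityˡ _)
        (sumFin-pair n (f ∘ fsuc) i j (i≢j ∘ cong fsuc)
                     (λ k k≢i k≢j → f≡0 (fsuc k) (k≢i ∘ suc-injective) (k≢j ∘ suc-injective)))

module ArrowEdge {n : ℕ} {Q : Quiver n} (G : BaseGraph n Q) {i j : Fin n} (a : Arrow Q i j) where

  ε : Edge G
  ε = shared G i j (arrow-adj Q a)

  source≢target : i ≢ j
  source≢target refl = antisym Q a a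

  tileOri-source : tileOri G i ε ≡ just bw
  tileOri-source = arrow-bw G i j a

  tileOri-target : tileOri G j ε ≡ just wb
  tileOri-target with tileOri G j ε in eq
  ... | nothing = ⊥-elim (shared-in₂ G i j (arrow-adj Q a) eq)
  ... | just bw = ⊥-elim (opposite G i j ε source≢target tileOri-source eq)
  ... | just wb = refl

  tileOri-other : ∀ k → k ≢ i → k ≢ j → tileOri G k ε ≡ nothing
  tileOri-other k k≢i k≢j with tileOri G k ε in eq
  ... | nothing = refl
  ... | just _  = ⊥-elim (at-most-two G i j k ε source≢target (k≢j ∘ sym) (k≢i ∘ sym)
                            (shared-in₁ G i j (arrow-adj Q a))
                            (shared-in₂ G i j (arrow-adj Q a))
                            λ eq′ → case-nothing eq′ eq)
    where
    case-nothing : ∀ {m : Maybe Ori} {o} → m ≡ nothing → m ≡ just o → ⊥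
    case-nothing refl ()

  sumFin-tiles : (f : Fin n → ℤ) → (∀ k → tileOri G k ε ≡ nothing → f k ≡ + 0) →
                 sumFin n f ≡ f i + f j
  sumFin-tiles f f≡0 =
    sumFin-pair n f i j source≢target (λ k k≢i k≢j → f≡0 k (tileOri-other k k≢i k≢j))

  sumFin-tileOri : (g : Fin n → Maybe Ori → ℤ) → (∀ k → g k nothing ≡ + 0) →
                   sumFin n (λ k → g k (tileOri G k ε)) ≡ g i (just bw) + g j (just wb)
  sumFin-tileOri g g≡0 = begin
    sumFin n (λ k → g k (tileOri G k ε))
      ≡⟨ sumFin-tiles _ (λ k eq → trans (cong (g k) eq) (g≡0 k)) ⟩
    g i (tileOri G i ε) + g j (tileOri G j ε)
      ≡⟨ cong₂ (λ u v → g i u + g j v) tileOri-source tileOri-target ⟩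
    g i (just bw) + g j (just wb) ∎
    where open ≡-Reasoning

  bwBoundary-shared : ∀ S → bwBoundary G S ε ≡ b2z (S i ∧ not (S j))
  bwBoundary-shared S = begin
    bwBoundary G S ε
      ≡⟨ cong₂ (λ t s → if ⌊ t ℤ.≟ + 1 ⌋ then s else + 0)
               (sumFin-tileOri (λ k m → b2z (S k ∧ isEdgeOf m)) (λ k → cong b2z (∧-zeroʳ (S k))))
               (sumFin-tileOri (λ k m → b2z (S k ∧ isBW m)) (λ k → cong b2z (∧-zeroʳ (S k)))) ⟩
    boundaryOfPair (S i) (S j)
      ≡⟨ boundaryOfPair≡ (S i) (S j) ⟩
    b2z (S i ∧ not (S j)) ∎
    where
    open ≡-Reasoning
    boundaryOfPair : Bool → Bool → ℤ
    boundaryOfPair x y =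
      if ⌊ b2z (x ∧ true) + b2z (y ∧ true) ℤ.≟ + 1 ⌋ then b2z (x ∧ true) + b2z (y ∧ false) else + 0
    boundaryOfPair≡ : ∀ x y → boundaryOfPair x y ≡ b2z (x ∧ not y)
    boundaryOfPair≡ false false = refl
    boundaryOfPair≡ false true  = refl
    boundaryOfPair≡ true  false = refl
    boundaryOfPair≡ true  true  = refl

  flipDelta-source : flipDelta G i ε ≡ ℤ.-1ℤ
  flipDelta-source rewrite tileOri-source = refl

  flipDelta-target : flipDelta G j ε ≡ ℤ.1ℤ
  flipDelta-target rewrite tileOri-target = refl

  flipDelta-other : ∀ k → tileOri G k ε ≡ nothing → flipDelta G k ε ≡ + 0
  flipDelta-other k eq rewrite eq = refl

  flips-shared : (e : Fin n → ℤ) → sumFin n (λ k → e k * flipDelta G k ε) ≡ e j - e i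
  flips-shared e = begin
    sumFin n (λ k → e k * flipDelta G k ε)
      ≡⟨ sumFin-tiles _ (λ k eq → trans (cong (e k *_) (flipDelta-other k eq)) (ℤ.*-zeroʳ (e k))) ⟩
    e i * flipDelta G i ε + e j * flipDelta G j ε
      ≡⟨ cong₂ (λ u v → e i * u + e j * v) flipDelta-source flipDelta-target ⟩
    e i * ℤ.-1ℤ + e j * ℤ.1ℤ
      ≡⟨ cong₂ _+_ (trans (ℤ.*-comm (e i) ℤ.-1ℤ) (ℤ.-1*i≡-i (e i))) (ℤ.*-identityʳ (e j)) ⟩
    - e i + e j
      ≡⟨ ℤ.+-comm (- e i) (e j) ⟩
    e j - e i ∎
    where open ≡-Reasoning

  weight-shared : ∀ d e → weight G d e ε ≡
    (b2z (⌊ + 1 ℤ.≤? d i ⌋ ∧ not ⌊ + 1 ℤ.≤? d j ⌋) + b2z (⌊ d i ℤ.≟ + 2 ⌋ ∧ not ⌊ d j ℤ.≟ + 2 ⌋))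
    + (e j - e i)
  weight-shared d e =
    cong₂ _+_ (cong₂ _+_ (bwBoundary-shared _) (bwBoundary-shared _)) (flips-shared e)

data RootCoeff : ℤ → Set where
  coeff0 : RootCoeff (+ 0)
  coeff1 : RootCoeff (+ 1)
  coeff2 : RootCoeff (+ 2)

if-RootCoeff : ∀ b {x y} → RootCoeff x → RootCoeff y → RootCoeff (if b then x else y)
if-RootCoeff true  cx _  = cx
if-RootCoeff false _  cy = cy

posRoot-coeff : ∀ {n d} → PosRoot n d → ∀ k → RootCoeff (d k)
posRoot-coeff (connected S _ d≡) k rewrite d≡ k = if-RootCoeff (S k) coeff1 coeff0
posRoot-coeff {n} (long i j _ _ d≡) k rewrite d≡ k =
  if-RootCoeff ⌊ toℕ k ℕ.<? i ⌋ coeff0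
    (if-RootCoeff ⌊ toℕ k ℕ.<? j ⌋ coeff1
      (if-RootCoeff ⌊ toℕ k ℕ.≤? n ℕ.∸ 3 ⌋ coeff2 coeff1))

-- Counts the levels ℓ ∈ {1, 2} with y < ℓ ≤ x.
levelsCrossed≡⊔ : ∀ {x y} → RootCoeff x → RootCoeff y →
  b2z (⌊ + 1 ℤ.≤? x ⌋ ∧ not ⌊ + 1 ℤ.≤? y ⌋) + b2z (⌊ x ℤ.≟ + 2 ⌋ ∧ not ⌊ y ℤ.≟ + 2 ⌋)
    ≡ (x - y) ⊔ + 0
levelsCrossed≡⊔ coeff0 coeff0 = refl
levelsCrossed≡⊔ coeff0 coeff1 = refl
levelsCrossed≡⊔ coeff0 coeff2 = refl
levelsCrossed≡⊔ coeff1 coeff0 = refl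
levelsCrossed≡⊔ coeff1 coeff1 = refl
levelsCrossed≡⊔ coeff1 coeff2 = refl
levelsCrossed≡⊔ coeff2 coeff0 = refl
levelsCrossed≡⊔ coeff2 coeff1 = refl
levelsCrossed≡⊔ coeff2 coeff2 = refl

lemma4p1 : (n : ℕ) → 4 ≤ℕ n → (Q : Quiver n) → (G : BaseGraph n Q) →
           (d : Fin n → ℤ) → PosRoot n d →
           (e : Fin n → ℤ) → (∀ k → + 0 ≤ e k × e k ≤ d k) →
           ∀ i j (a : Arrow Q i j) →
           weight G d e (shared G i j (arrow-adj Q a)) ≡ ((d i - d j) ⊔ + 0) + (e j - e i)
lemma4p1 n _ Q G d root e _ i j a =
  trans (ArrowEdge.weight-shared G a d e)
        (cong (_+ (e j - e i)) (levelsCrossed≡⊔ (posRoot-coeff root i) (posRoot-coeff root j)))
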